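{- Let $n_1, n_2, \dots$ be a sequence of integers greater than $1$, let $m_j = n_1 n_2 \cdots n_j$ for $j \geq 0$ (so $m_0 = 1$), and for $i \geq 1$ let $a_i = 0$ if the greatest $j \ge 0$ such that $m_j$ divides $i$ is even and $a_i = 1$ otherwise. Then the infinite word $U = a_1 a_2 a_3 \cdots$ is uniformly recurrent.
   Context: An infinite word $w$ is uniformly recurrent if for every factor $u$ of $w$ there is an $N$ such that every factor of $w$ of length $N$ contains $u$. -}

module Defs where

open import Data.Nat using (ℕ; zero; suc; _+_; _*_; _≤_; _<_)
open import Data.Nat.Divisibility using (_∣_; _∣?_)
open import Data.Bool using (Bool; true; false; not; if_then_else_)
open import Data.List using (List; map; length; upTo)
open import Data.Product using (∃; _×_)
open import Relation.Binary.PropositionalEquality using (_≡_)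
open import Relation.Nullary.Decidable using (does)

Word : Set → Set
Word A = ℕ → A

factorAt : {A : Set} → Word A → ℕ → ℕ → List A
factorAt w p len = map (λ t → w (p + t)) (upTo len)

IsFactor : {A : Set} → List A → Word A → Set
IsFactor u w = ∃ λ p → factorAt w p (length u) ≡ u

EveryWindowContains : {A : Set} → Word A → ℕ → List A → Set
EveryWindowContains w N u =
  ∀ p → ∃ λ q → p ≤ q × q + length u ≤ p + N × factorAt w q (length u) ≡ u

UniformlyRecurrent : {A : Set} → Word A → Set
UniformlyRecurrent {A} w =
  ∀ (u : List A) → IsFactor u w → ∃ λ N → EveryWindowContains w N u

-- The sequence n_1, n_2, ... is given as ns : ℕ → ℕ with n_{k+1} = ns k.
-- m_0 = 1, m_{j+1} = m_j * n_{j+1}.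
m : (ℕ → ℕ) → ℕ → ℕ
m ns zero = 1
m ns (suc j) = m ns j * ns j

greatestUpTo : (ℕ → ℕ) → ℕ → ℕ → ℕ
greatestUpTo ns i zero = zero
greatestUpTo ns i (suc b) =
  if does (m ns (suc b) ∣? i) then suc b else greatestUpTo ns i b

-- For i ≥ 1 and all n_k > 1, m_j ≥ 2^j > j, so m_j ∣ i forces j < i;
-- hence the greatest j ≥ 0 with m_j ∣ i is greatestUpTo ns i i.
greatestDiv : (ℕ → ℕ) → ℕ → ℕ
greatestDiv ns i = greatestUpTo ns i i

isOdd : ℕ → Bool
isOdd zero = false
isOdd (suc k) = not (isOdd k)

-- a_i for i ≥ 1, letter 0 encoded as false, 1 as true.
a : (ℕ → ℕ) → ℕ → Bool
a ns i = isOdd (greatestDiv ns i)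

-- U = a_1 a_2 a_3 ...; position k of the word is a_{k+1}.
U : (ℕ → ℕ) → Word Bool
U ns k = a ns (suc k)

-- Write M = m_J.  For 0 < i < M the index of the largest m_j dividing i is
-- below J, and since every m_j with j ≤ J divides c·M, shifting i by c·M
-- changes neither which of these m_j divide it nor (as M still does not
-- divide it) any larger one.  So a_{i + cM} = a_i: the prefix of U of length
-- n reappears at every multiple of m_n, and every window of length m_n + n
-- contains one of these copies.
module Submission where

open import Defs
open import Data.Nat.Base
open import Data.Nat.Properties
open import Data.Nat.Divisibility
open import Data.Nat.DivMod
open import Data.List using (length)
open import Data.List.Properties using (map-cong-local)
import Data.List.Relation.Unary.All as All
open import Data.List.Relation.Unary.All.Properties using (all-upTo)
open import Data.Product using (∃; _×_; _,_)
open import Data.Sum using (inj₁; inj₂)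
open import Relation.Nullary using (yes; no; contradiction)
open import Relation.Binary.PropositionalEquality
open import Function using (_∘′_)

module _ {A : Set} (w : Word A) where

  factorAt-cong : ∀ {p q} L → (∀ t → t < L → w (q + t) ≡ w (p + t)) →
                  factorAt w q L ≡ factorAt w p L
  factorAt-cong L eq = map-cong-local (All.map (eq _) (all-upTo L))

PrefixPeriodic : {A : Set} → Word A → Set
PrefixPeriodic w = ∀ n → ∃ λ P → NonZero P × (∀ c t → t < n → w (c * P + t) ≡ w t)

prefixPeriodic⇒uniformlyRecurrent : {A : Set} {w : Word A} →
                                    PrefixPeriodic w → UniformlyRecurrent w
prefixPeriodic⇒uniformlyRecurrent {w = w} periodic u (p , occurs)
  with periodic (p + length u)
... | P , P≢0 , shift = P + (p + L) , window
  where
  L = length u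
  instance
    _ : NonZero P
    _ = P≢0

  -- the occurrence at p shifted to the first multiple of P beyond r
  window : EveryWindowContains w (P + (p + L)) u
  window r = q , r≤q , q+L≤r+N , trans (factorAt-cong w L shifted) occurs
    where
    c = suc (r / P)
    q = c * P + p

    r≤q : r ≤ q
    r≤q = ≤-trans (<⇒≤ r<cP) (m≤m+n (c * P) p)
      where
      r<cP : r < c * P
      r<cP = begin-strict
        r                   ≡⟨ m≡m%n+[m/n]*n r P ⟩
        r % P + r / P * P   <⟨ +-monoˡ-< (r / P * P) (m%n<n r P) ⟩
        c * P               ∎
        where open ≤-Reasoning

    q+L≤r+N : q + L ≤ r + (P + (p + L))
    q+L≤r+N = begin
      c * P + p + L        ≡⟨ +-assoc (c * P) p L ⟩
      c * P + (p + L)      ≤⟨ +-monoˡ-≤ (p + L) (+-monoʳ-≤ P (m/n*n≤m r P)) ⟩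
      P + r + (p + L)      ≡⟨ cong (_+ (p + L)) (+-comm P r) ⟩
      r + P + (p + L)      ≡⟨ +-assoc r P (p + L) ⟩
      r + (P + (p + L))    ∎
      where open ≤-Reasoning

    shifted : ∀ t → t < L → w (q + t) ≡ w (p + t)
    shifted t t<L = trans (cong w (+-assoc (c * P) p t))
                          (shift c (p + t) (+-monoʳ-< p t<L))

module _ (ns : ℕ → ℕ) where

  m-∣-mono : ∀ {j k} → j ≤ k → m ns j ∣ m ns k
  m-∣-mono {k = zero}  z≤n = ∣-refl
  m-∣-mono {k = suc k} j≤1+k with m≤n⇒m<n∨m≡n j≤1+k
  ... | inj₁ j<1+k = ∣m⇒∣m*n (ns k) (m-∣-mono (s≤s⁻¹ j<1+k))
  ... | inj₂ refl  = ∣-refl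

  MaxDivIndex : ℕ → ℕ → Set
  MaxDivIndex y g = m ns g ∣ y × (∀ j → g < j → m ns j ∤ y)

  greatestUpTo-∣ : ∀ y b → m ns (greatestUpTo ns y b) ∣ y
  greatestUpTo-∣ y zero = 1∣ y
  greatestUpTo-∣ y (suc b) with m ns (suc b) ∣? y
  ... | yes m∣y = m∣y
  ... | no  _   = greatestUpTo-∣ y b

  greatestUpTo-maximal : ∀ y b j → greatestUpTo ns y b < j → j ≤ b → m ns j ∤ y
  greatestUpTo-maximal y zero j g<j j≤0 _ = <⇒≱ g<j j≤0
  greatestUpTo-maximal y (suc b) j g<j j≤1+b with m ns (suc b) ∣? y
  ... | yes _ = contradiction j≤1+b (<⇒≱ g<j)
  ... | no m∤y with m≤n⇒m<n∨m≡n j≤1+b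
  ...   | inj₁ j<1+b = greatestUpTo-maximal y b j g<j (s≤s⁻¹ j<1+b)
  ...   | inj₂ refl  = m∤y

  greatestUpTo-unique : ∀ {y g} b → g ≤ b → MaxDivIndex y g → greatestUpTo ns y b ≡ g
  greatestUpTo-unique zero z≤n _ = refl
  greatestUpTo-unique {y} (suc b) g≤1+b (_ , above) with m ns (suc b) ∣? y
  ... | yes m∣y′ with m≤n⇒m<n∨m≡n g≤1+b
  ...   | inj₁ g<1+b = contradiction m∣y′ (above (suc b) g<1+b)
  ...   | inj₂ g≡1+b = sym g≡1+b
  greatestUpTo-unique {y} (suc b) g≤1+b max@(m∣y , _) | no m∤y
    with m≤n⇒m<n∨m≡n g≤1+b
  ...   | inj₁ g<1+b = greatestUpTo-unique b (s≤s⁻¹ g<1+b) max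
  ...   | inj₂ refl  = contradiction m∣y m∤y

  maxDivIndex-shift : ∀ {i g} J c → m ns J ∤ i →
                      MaxDivIndex i g → MaxDivIndex (i + c * m ns J) g
  maxDivIndex-shift {i} {g} J c M∤i (m∣i , above) = m∣i+cM , above′
    where
    M = m ns J

    ∣cM : ∀ {j} → j ≤ J → m ns j ∣ c * M
    ∣cM j≤J = ∣n⇒∣m*n c (m-∣-mono j≤J)

    unshift : ∀ {d} → d ∣ c * M → d ∣ i + c * M → d ∣ i
    unshift {d} d∣cM d∣i+cM = ∣m+n∣m⇒∣n (subst (d ∣_) (+-comm i (c * M)) d∣i+cM) d∣cM

    g<J : g < J
    g<J with g <? J
    ... | yes g<J = g<J
    ... | no  g≮J = contradiction (∣-trans (m-∣-mono (≮⇒≥ g≮J)) m∣i) M∤i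

    m∣i+cM : m ns g ∣ i + c * M
    m∣i+cM = ∣m∣n⇒∣m+n m∣i (∣cM (<⇒≤ g<J))

    above′ : ∀ j → g < j → m ns j ∤ i + c * M
    above′ j g<j m∣i+cM with j ≤? J
    ... | yes j≤J = above j g<j (unshift (∣cM j≤J) m∣i+cM)
    ... | no  j≰J = M∤i (unshift (∣cM ≤-refl)
                                  (∣-trans (m-∣-mono (<⇒≤ (≰⇒> j≰J))) m∣i+cM))

module _ (ns : ℕ → ℕ) (ns>1 : ∀ k → 1 < ns k) where

  j<m : ∀ j → j < m ns j
  j<m zero    = z<s
  j<m (suc j) = ≤-<-trans (j<m j) (m<m*n (m ns j) (ns j) (ns>1 j))
    where
    instance
      _ : NonZero (m ns j)
      _ = >-nonZero (≤-<-trans z≤n (j<m j))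

  greatestDiv-maxDivIndex : ∀ y → .{{NonZero y}} → MaxDivIndex ns y (greatestDiv ns y)
  greatestDiv-maxDivIndex y = greatestUpTo-∣ ns y y , above
    where
    above : ∀ j → greatestDiv ns y < j → m ns j ∤ y
    above j g<j with j ≤? y
    ... | yes j≤y = greatestUpTo-maximal ns y y j g<j j≤y
    ... | no  j≰y = >⇒∤ (<-trans (≰⇒> j≰y) (j<m j))

  greatestDiv-unique : ∀ {y g} → .{{NonZero y}} → MaxDivIndex ns y g → greatestDiv ns y ≡ g
  greatestDiv-unique {y} {g} max@(m∣y , _) =
    greatestUpTo-unique ns y (<⇒≤ (<-≤-trans (j<m g) (∣⇒≤ m∣y))) max

  a-periodic : ∀ J c i → .{{NonZero i}} → i < m ns J → a ns (i + c * m ns J) ≡ a ns i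
  a-periodic J c i i<M = cong isOdd (greatestDiv-unique {{i+cM≢0}} shifted)
    where
    i+cM≢0 : NonZero (i + c * m ns J)
    i+cM≢0 = >-nonZero (<-≤-trans (>-nonZero⁻¹ i) (m≤m+n i (c * m ns J)))

    shifted : MaxDivIndex ns (i + c * m ns J) (greatestDiv ns i)
    shifted = maxDivIndex-shift ns J c (>⇒∤ i<M) (greatestDiv-maxDivIndex i)

  U-prefixPeriodic : PrefixPeriodic (U ns)
  U-prefixPeriodic n = m ns n , >-nonZero (≤-<-trans z≤n (j<m n)) , periodic
    where
    periodic : ∀ c t → t < n → U ns (c * m ns n + t) ≡ U ns t
    periodic c t t<n = trans (cong (a ns ∘′ suc) (+-comm (c * m ns n) t))
                             (a-periodic n c (suc t) (≤-<-trans t<n (j<m n)))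

lemma11 : (ns : ℕ → ℕ) → (∀ k → 1 < ns k) → UniformlyRecurrent (U ns)
lemma11 ns ns>1 = prefixPeriodic⇒uniformlyRecurrent (U-prefixPeriodic ns ns>1)
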